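{- Let $G$ be a graph with vertices $v_1,\dots,v_n$. Construct the graph $H$ with turn costs $\alpha$ as follows: take a central vertex $c$ and, for each $i\in\{1,\dots,n\}$, a copy of the cycle $C_3$ with one of its vertices joined to $c$ by a bridge edge $b_i$; the triangle together with $b_i$ is called the arm $a_i$. At $c$, the turn $(b_i,b_j)$ for $i\ne j$ has cost $0$ if $v_iv_j\in E(G)$ and cost $1$ otherwise; every other turn of $H$ has cost $1$. Then $G$ contains a Hamiltonian cycle if and only if $H$ has a threading of turn cost $4n$.
   Context: A turn at a vertex $v$ is an unordered pair of distinct edges both incident to $v$; turn costs assign a nonnegative real to each turn. For a closed walk $W$, its turn cost is the sum of the costs of all consecutive pairs of edges of $W$, taken cyclically. The junction graph $J(v)$ induced by a closed walk at vertex $v$ has one vertex for each edge incident to $v$, and an edge between two of these vertices every time the walk visits $v$ immediately in between traversing the corresponding two edges. A threading of a graph is a closed walk that traverses every edge at least once, has no U-turns (never traverses the same edge twice in immediate succession, cyclically), and induces a connected junction graph at every vertex. A Hamiltonian cycle is a cycle visiting every vertex exactly once. -}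

module Defs where

open import Data.Nat using (ℕ; zero; suc; _+_)
open import Data.Nat.DivMod using (_mod_)
open import Data.Fin using (Fin; toℕ)
open import Data.Bool using (Bool; true; false; if_then_else_)
open import Data.List using (List; map; allFin)
open import Data.Nat.ListAction using (sum)
open import Data.Product using (Σ; ∃; _×_; _,_; proj₁; proj₂)
open import Data.Sum using (_⊎_)
open import Relation.Binary.PropositionalEquality using (_≡_; _≢_)

next : ∀ {n} → Fin n → Fin n
next {suc k} i = suc (toℕ i) mod (suc k)

prev : ∀ {n} → Fin n → Fin n
prev {suc k} i = (toℕ i + k) mod (suc k)

record SimpleGraph (n : ℕ) : Set where
  field
    adj   : Fin n → Fin n → Bool
    sym   : ∀ i j → adj i j ≡ adj j i
    irrefl : ∀ i → adj i i ≡ false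

open SimpleGraph public

HamiltonianCycle : ∀ {n} → SimpleGraph n → Set
HamiltonianCycle {n} G =
  Σ (Fin n → Fin n) λ σ →
    (∀ {i j} → σ i ≡ σ j → i ≡ j) ×
    (∀ v → ∃ λ i → σ i ≡ v) ×
    (∀ i → adj G (σ i) (σ (next i)) ≡ true)

record Graph : Set₁ where
  field
    V    : Set
    E    : Set
    ends : E → V × V

open Graph public

Incident : (Γ : Graph) → V Γ → E Γ → Set
Incident Γ v e = (v ≡ proj₁ (ends Γ e)) ⊎ (v ≡ proj₂ (ends Γ e))

Joins : (Γ : Graph) → E Γ → V Γ → V Γ → Set
Joins Γ e u w = (ends Γ e ≡ (u , w)) ⊎ (ends Γ e ≡ (w , u))

-- The walk visits w_i immediately between traversing e_{i-1} and e_i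
-- (indices cyclic).
record ClosedWalk (Γ : Graph) : Set where
  field
    len  : ℕ
    vs   : Fin (suc len) → V Γ
    es   : Fin (suc len) → E Γ
    step : ∀ i → Joins Γ (es i) (vs i) (vs (next i))

open ClosedWalk public

-- Turn costs: α v e f is the cost of the turn {e,f} at v (only ever
-- evaluated on turns, i.e. distinct edges e, f both incident to v).
TurnCosts : Graph → Set
TurnCosts Γ = V Γ → E Γ → E Γ → ℕ

turnCost : ∀ {Γ} → TurnCosts Γ → ClosedWalk Γ → ℕ
turnCost α W =
  sum (map (λ i → α (vs W i) (es W (prev i)) (es W i)) (allFin (suc (len W))))

Covers : ∀ {Γ} → ClosedWalk Γ → Set
Covers {Γ} W = ∀ (x : E Γ) → ∃ λ i → es W i ≡ x

NoUTurn : ∀ {Γ} → ClosedWalk Γ → Set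
NoUTurn W = ∀ i → es W (prev i) ≢ es W i

-- Junction graph J(v): vertices = edges incident to v; one edge {e,f}
-- for each visit i of v (vs i ≡ v) with {e_{i-1}, e_i} = {e,f}.
JEdge : ∀ {Γ} → ClosedWalk Γ → V Γ → E Γ → E Γ → Set
JEdge W v e f = ∃ λ i → (vs W i ≡ v) ×
  ((e ≡ es W (prev i) × f ≡ es W i) ⊎ (e ≡ es W i × f ≡ es W (prev i)))

data JPath {Γ : Graph} (W : ClosedWalk Γ) (v : V Γ) : E Γ → E Γ → Set where
  here  : ∀ {e} → JPath W v e e
  there : ∀ {e f g} → JEdge W v e f → JPath W v f g → JPath W v e g

JunctionConnected : ∀ {Γ} → ClosedWalk Γ → V Γ → Set
JunctionConnected {Γ} W v =
  ∀ e f → Incident Γ v e → Incident Γ v f → JPath W v e f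

record IsThreading {Γ : Graph} (W : ClosedWalk Γ) : Set where
  field
    covers    : Covers W
    noUTurn   : NoUTurn W
    connected : ∀ v → JunctionConnected W v

data HV (n : ℕ) : Set where
  c : HV n
  x y z : Fin n → HV n

data HE (n : ℕ) : Set where
  b xy yz zx : Fin n → HE n

endsH : ∀ {n} → HE n → HV n × HV n
endsH (b i)  = c , x i
endsH (xy i) = x i , y i
endsH (yz i) = y i , z i
endsH (zx i) = z i , x i

H : ℕ → Graph
H n = record { V = HV n ; E = HE n ; ends = endsH }

αH : ∀ {n} → SimpleGraph n → TurnCosts (H n)
αH G c (b i) (b j) = if adj G i j then 0 else 1
αH G _ _ _ = 1

-- A Hamiltonian cycle gives a threading that runs through the arms in cycle
-- order, each as c, x, y, z, x, c: the four turns inside an arm cost 1 and the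
-- turn at c between consecutive (adjacent) arms is free, 4n in total.
--
-- Conversely, J(x_i) has three vertices, so a threading visits every x_i at
-- least twice and every y_i, z_i at least once, and each of these 4n visits
-- costs at least 1. In a threading of cost 4n there are thus no further visits
-- off c and all turns at c are free. Leaving c along b_j the walk must then go
-- once around the triangle of arm j and return over b_j, and the free turn at c
-- leads on to an arm adjacent to j. The resulting sequence of arms repeats
-- exactly when the walk does, which makes it periodic with minimal period n;
-- one period is a Hamiltonian cycle of G.

module Submission where

open import Defs hiding (sym)
open import Data.Nat using (ℕ; zero; suc; _+_; _*_; _≤_; _<_; z≤n; s≤s)
open import Data.Nat.Properties
open import Data.Nat.DivMod
  using (_%_; _mod_; _/_; m%n<n; m%n%n≡m%n; %-distribˡ-+; [m+n]%n≡m%n; [m+kn]%n≡m%n; m≡m%n+[m/n]*n; m<n⇒m%n≡m)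
open import Data.Fin as Fin using (Fin; toℕ; punchIn; punchOut; inject₁; fromℕ; remQuot; combine)
open import Data.Fin.Patterns using (0F; 1F; 2F; 3F)
import Data.Fin.Properties as Finₚ
open import Data.Fin.Properties using (toℕ-injective; toℕ-fromℕ<; toℕ<n; any?; pigeonhole; injective⇒≤)
open import Data.Bool using (true; false)
open import Data.List using (map; allFin; tabulate)
open import Data.List.Properties using (map-tabulate)
import Data.Nat.ListAction as List
open import Algebra.Properties.CommutativeMonoid.Sum +-0-commutativeMonoid
  using (sum; sum-remove; sum-init-last; sum-cong-≗)
open import Algebra.Properties.CommutativeSemigroup +-commutativeSemigroup using (x∙yz≈y∙xz)
open import Data.Vec.Functional using (_∷_)
open import Data.Product using (Σ; ∃; ∃₂; _×_; _,_; proj₁; proj₂; uncurry)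
open import Data.Sum using (_⊎_; inj₁; inj₂)
open import Data.Empty using (⊥; ⊥-elim)
open import Relation.Nullary using (¬_; yes; no)
open import Relation.Binary.Definitions using (tri<; tri≈; tri>)
open import Relation.Binary.PropositionalEquality
open import Function using (_∘_; id)
open import Function.Bundles using (_⇔_; mk⇔)
open import Function.Definitions using (Injective)

list-sum-tabulate : ∀ {m} (f : Fin m → ℕ) → List.sum (tabulate f) ≡ sum f
list-sum-tabulate {zero} f = refl
list-sum-tabulate {suc m} f = cong (f Fin.zero +_) (list-sum-tabulate (f ∘ Fin.suc))

list-sum-allFin : ∀ {m} (f : Fin m → ℕ) → List.sum (map f (allFin m)) ≡ sum f
list-sum-allFin f = trans (cong List.sum (map-tabulate id f)) (list-sum-tabulate f)

length≤sum : ∀ {m} {f : Fin m → ℕ} → (∀ i → 1 ≤ f i) → m ≤ sum f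
length≤sum {zero} _ = z≤n
length≤sum {suc m} 1≤f = +-mono-≤ (1≤f Fin.zero) (length≤sum (1≤f ∘ Fin.suc))

sum-∘-injective-≤ : ∀ {m n} (g : Fin m → Fin n) → Injective _≡_ _≡_ g →
                    (h : Fin n → ℕ) → sum (h ∘ g) ≤ sum h
sum-∘-injective-≤ {zero} g _ h = z≤n
sum-∘-injective-≤ {suc m} {zero} g _ h with g Fin.zero
... | ()
sum-∘-injective-≤ {suc m} {suc n} g g-inj h = begin
  h p + sum (h ∘ g ∘ Fin.suc)         ≡⟨ cong (h p +_) (sum-cong-≗ (λ k → cong h (sym (Finₚ.punchIn-punchOut (p≢ k))))) ⟩
  h p + sum (h ∘ punchIn p ∘ g′)      ≤⟨ +-monoʳ-≤ (h p) (sum-∘-injective-≤ g′ g′-inj (h ∘ punchIn p)) ⟩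
  h p + sum (h ∘ punchIn p)           ≡⟨ sum-remove h ⟨
  sum h                               ∎
  where
  open ≤-Reasoning
  p = g Fin.zero
  p≢ : ∀ k → p ≢ g (Fin.suc k)
  p≢ k e with g-inj e
  ... | ()
  g′ : Fin m → Fin n
  g′ k = punchOut (p≢ k)
  g′-inj : Injective _≡_ _≡_ g′
  g′-inj e = Finₚ.suc-injective (g-inj (Finₚ.punchOut-injective (p≢ _) (p≢ _) e))

weight-in-image : ∀ {m n} (g : Fin m → Fin n) → Injective _≡_ _≡_ g →
                  {h : Fin n → ℕ} → (∀ k → 1 ≤ h (g k)) → sum h ≤ m →
                  ∀ p → 1 ≤ h p → ∃ λ k → g k ≡ p
weight-in-image {m} g g-inj {h} 1≤h∘g sum≤m p 1≤hp with any? (λ k → g k Fin.≟ p)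
... | yes hit = hit
... | no miss = ⊥-elim (<-irrefl refl (begin
  suc m            ≤⟨ length≤sum {f = h ∘ g⁺} (λ { Fin.zero → 1≤hp ; (Fin.suc k) → 1≤h∘g k }) ⟩
  sum (h ∘ g⁺)     ≤⟨ sum-∘-injective-≤ g⁺ g⁺-inj h ⟩
  sum h            ≤⟨ sum≤m ⟩
  m                ∎))
  where
  open ≤-Reasoning
  g⁺ = p ∷ g
  g⁺-inj : Injective _≡_ _≡_ g⁺
  g⁺-inj {Fin.zero} {Fin.zero} _ = refl
  g⁺-inj {Fin.zero} {Fin.suc k} e = ⊥-elim (miss (k , sym e))
  g⁺-inj {Fin.suc k} {Fin.zero} e = ⊥-elim (miss (k , e))
  g⁺-inj {Fin.suc k} {Fin.suc k′} e = cong Fin.suc (g-inj e)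

periodic-% : ∀ {a} {A : Set a} (f : ℕ → A) d → (∀ t → f (suc d + t) ≡ f t) → ∀ t → f (t % suc d) ≡ f t
periodic-% f d f-periodic t = begin
  f (t % N)                 ≡⟨ unwind (t / N) (t % N) ⟨
  f (t % N + (t / N) * N)   ≡⟨ cong f (m≡m%n+[m/n]*n t N) ⟨
  f t                       ∎
  where
  open ≡-Reasoning
  N = suc d
  unwind : ∀ q r → f (r + q * N) ≡ f r
  unwind zero r = cong f (+-identityʳ r)
  unwind (suc q) r = begin
    f (r + (N + q * N))   ≡⟨ cong f (x∙yz≈y∙xz r N (q * N)) ⟩
    f (N + (r + q * N))   ≡⟨ f-periodic (r + q * N) ⟩
    f (r + q * N)         ≡⟨ unwind q r ⟩
    f r                   ∎

module Cyclic (len : ℕ) where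

  ⟦_⟧ : ℕ → Fin (suc len)
  ⟦ t ⟧ = t mod suc len

  toℕ-⟦⟧ : ∀ t → toℕ ⟦ t ⟧ ≡ t % suc len
  toℕ-⟦⟧ t = toℕ-fromℕ< (m%n<n t (suc len))

  ⟦⟧-≡ : ∀ {t u} → t % suc len ≡ u % suc len → ⟦ t ⟧ ≡ ⟦ u ⟧
  ⟦⟧-≡ {t} {u} e = toℕ-injective (trans (toℕ-⟦⟧ t) (trans e (sym (toℕ-⟦⟧ u))))

  ⟦toℕ⟧ : ∀ i → ⟦ toℕ i ⟧ ≡ i
  ⟦toℕ⟧ i = toℕ-injective (trans (toℕ-⟦⟧ (toℕ i)) (m<n⇒m%n≡m (toℕ<n i)))

  next-⟦⟧ : ∀ t → next ⟦ t ⟧ ≡ ⟦ suc t ⟧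
  next-⟦⟧ t = ⟦⟧-≡ {suc (toℕ ⟦ t ⟧)} {suc t} (begin
    suc (toℕ ⟦ t ⟧) % N             ≡⟨ cong (λ u → suc u % N) (toℕ-⟦⟧ t) ⟩
    (1 + t % N) % N                 ≡⟨ %-distribˡ-+ 1 (t % N) N ⟩
    (1 % N + t % N % N) % N         ≡⟨ cong (λ u → (1 % N + u) % N) (m%n%n≡m%n t N) ⟩
    (1 % N + t % N) % N             ≡⟨ %-distribˡ-+ 1 t N ⟨
    suc t % N                       ∎)
    where open ≡-Reasoning
          N = suc len

  ⟦period+⟧ : ∀ t → ⟦ suc len + t ⟧ ≡ ⟦ t ⟧
  ⟦period+⟧ t = ⟦⟧-≡ {suc len + t} {t} (trans (cong (_% suc len) (+-comm (suc len) t)) ([m+n]%n≡m%n t (suc len)))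

  ⟦⟧-congˡ : ∀ k {t u} → ⟦ t ⟧ ≡ ⟦ u ⟧ → ⟦ k + t ⟧ ≡ ⟦ k + u ⟧
  ⟦⟧-congˡ zero e = e
  ⟦⟧-congˡ (suc k) {t} {u} e =
    trans (sym (next-⟦⟧ (k + t))) (trans (cong next (⟦⟧-congˡ k e)) (next-⟦⟧ (k + u)))

  prev-⟦suc⟧ : ∀ t → prev ⟦ suc t ⟧ ≡ ⟦ t ⟧
  prev-⟦suc⟧ t = begin
    ⟦ toℕ ⟦ suc t ⟧ + len ⟧   ≡⟨ cong ⟦_⟧ (+-comm (toℕ ⟦ suc t ⟧) len) ⟩
    ⟦ len + toℕ ⟦ suc t ⟧ ⟧   ≡⟨ ⟦⟧-congˡ len (⟦toℕ⟧ ⟦ suc t ⟧) ⟩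
    ⟦ len + suc t ⟧           ≡⟨ cong ⟦_⟧ (+-suc len t) ⟩
    ⟦ suc len + t ⟧           ≡⟨ ⟦period+⟧ t ⟩
    ⟦ t ⟧                     ∎
    where open ≡-Reasoning

  ⟦⟧-cancelˡ : ∀ k {t u} → ⟦ k + t ⟧ ≡ ⟦ k + u ⟧ → ⟦ t ⟧ ≡ ⟦ u ⟧
  ⟦⟧-cancelˡ zero e = e
  ⟦⟧-cancelˡ (suc k) {t} {u} e =
    ⟦⟧-cancelˡ k (trans (sym (prev-⟦suc⟧ (k + t))) (trans (cong prev e) (prev-⟦suc⟧ (k + u))))

  ⟦+*period⟧ : ∀ t k → ⟦ t + k * suc len ⟧ ≡ ⟦ t ⟧
  ⟦+*period⟧ t k = ⟦⟧-≡ {t + k * suc len} {t} ([m+kn]%n≡m%n t k (suc len))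

  periodic-toℕ-⟦⟧ : ∀ {a} {A : Set a} (f : ℕ → A) → (∀ t → f (suc len + t) ≡ f t) →
                    ∀ t → f (toℕ ⟦ t ⟧) ≡ f t
  periodic-toℕ-⟦⟧ f f-periodic t = trans (cong f (toℕ-⟦⟧ t)) (periodic-% f len f-periodic t)

  sum-∘-next : (f : Fin (suc len) → ℕ) → sum (f ∘ next) ≡ sum f
  sum-∘-next f = begin
    sum (f ∘ next)                          ≡⟨ sum-init-last (f ∘ next) ⟩
    sum (f ∘ next ∘ inject₁) + f (next (fromℕ len)) ≡⟨ cong₂ _+_ (sum-cong-≗ (cong f ∘ next-inject₁)) (cong f next-fromℕ) ⟩
    sum (f ∘ Fin.suc) + f Fin.zero          ≡⟨ +-comm _ (f Fin.zero) ⟩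
    sum f                                   ∎
    where
    open ≡-Reasoning
    next-inject₁ : ∀ i → next (inject₁ i) ≡ Fin.suc i
    next-inject₁ i = begin
      next (inject₁ i)                   ≡⟨ cong next (⟦toℕ⟧ (inject₁ i)) ⟨
      next ⟦ toℕ (inject₁ i) ⟧           ≡⟨ next-⟦⟧ _ ⟩
      ⟦ suc (toℕ (inject₁ i)) ⟧          ≡⟨ cong (⟦_⟧ ∘ suc) (Finₚ.toℕ-inject₁ i) ⟩
      ⟦ toℕ (Fin.suc i) ⟧                ≡⟨ ⟦toℕ⟧ (Fin.suc i) ⟩
      Fin.suc i                          ∎
    next-fromℕ : next (fromℕ len) ≡ Fin.zero
    next-fromℕ = begin
      next (fromℕ len)                   ≡⟨ cong next (⟦toℕ⟧ (fromℕ len)) ⟨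
      next ⟦ toℕ (fromℕ len) ⟧           ≡⟨ next-⟦⟧ _ ⟩
      ⟦ suc (toℕ (fromℕ len)) ⟧          ≡⟨ cong (⟦_⟧ ∘ suc) (Finₚ.toℕ-fromℕ len) ⟩
      ⟦ suc len ⟧                        ≡⟨ cong ⟦_⟧ (+-identityʳ (suc len)) ⟨
      ⟦ suc len + 0 ⟧                    ≡⟨ ⟦period+⟧ 0 ⟩
      Fin.zero                           ∎

turnAt : ∀ {Γ} → TurnCosts Γ → (W : ClosedWalk Γ) → Fin (suc (len W)) → ℕ
turnAt α W i = α (vs W i) (es W (prev i)) (es W i)

turnCost≡sum-turnAt : ∀ {Γ} (α : TurnCosts Γ) (W : ClosedWalk Γ) → turnCost α W ≡ sum (turnAt α W)
turnCost≡sum-turnAt α W = list-sum-allFin (turnAt α W)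

module _ {Γ : Graph} {W : ClosedWalk Γ} {v : V Γ} where

  JEdge-sym : ∀ {e f} → JEdge W v e f → JEdge W v f e
  JEdge-sym (i , at , inj₁ (e≡ , f≡)) = i , at , inj₂ (f≡ , e≡)
  JEdge-sym (i , at , inj₂ (e≡ , f≡)) = i , at , inj₁ (f≡ , e≡)

  _++ᴶ_ : ∀ {e f g} → JPath W v e f → JPath W v f g → JPath W v e g
  here ++ᴶ q = q
  there ef p ++ᴶ q = there ef (p ++ᴶ q)

  JPath-reverse : ∀ {e f} → JPath W v e f → JPath W v f e
  JPath-reverse here = here
  JPath-reverse (there ef p) = JPath-reverse p ++ᴶ there (JEdge-sym ef) here

  connected-via : (hub : E Γ) → (∀ e → Incident Γ v e → JPath W v hub e) → JunctionConnected W v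
  connected-via hub reach e f v∈e v∈f = JPath-reverse (reach e v∈e) ++ᴶ reach f v∈f

  JPath-first-edge : ∀ {e f} → e ≢ f → JPath W v e f → ∃ λ f′ → JEdge W v e f′
  JPath-first-edge e≢f here = ⊥-elim (e≢f refl)
  JPath-first-edge _ (there ef _) = _ , ef

  private
    at-most-two : ∀ {i e f g h} →
      (e ≡ es W (prev i) × f ≡ es W i) ⊎ (e ≡ es W i × f ≡ es W (prev i)) →
      (g ≡ es W (prev i) × h ≡ es W i) ⊎ (g ≡ es W i × h ≡ es W (prev i)) →
      g ≢ e → g ≢ f → ⊥
    at-most-two (inj₁ (refl , refl)) (inj₁ (g≡ , _)) g≢e _ = g≢e g≡
    at-most-two (inj₁ (refl , refl)) (inj₂ (g≡ , _)) _ g≢f = g≢f g≡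
    at-most-two (inj₂ (refl , refl)) (inj₁ (g≡ , _)) _ g≢f = g≢f g≡
    at-most-two (inj₂ (refl , refl)) (inj₂ (g≡ , _)) g≢e _ = g≢e g≡

  visited : JunctionConnected W v → ∀ {e f} → Incident Γ v e → Incident Γ v f → e ≢ f →
            ∃ λ i → vs W i ≡ v
  visited conn v∈e v∈f e≢f with JPath-first-edge e≢f (conn _ _ v∈e v∈f)
  ... | _ , i , at-i , _ = i , at-i

  -- A visit contributes one edge to J(v), so a connected J(v) with a third
  -- vertex (supplied by `other`) needs two visits.
  visited-twice : JunctionConnected W v → ∀ {e f} → Incident Γ v e → Incident Γ v f → e ≢ f →
                  (other : ∀ f′ → ∃ λ g → Incident Γ v g × g ≢ e × g ≢ f′) →
                  ∃₂ λ i j → i ≢ j × vs W i ≡ v × vs W j ≡ v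
  visited-twice conn v∈e v∈f e≢f other
    with JPath-first-edge e≢f (conn _ _ v∈e v∈f)
  ... | f′ , i , at-i , e-f′
    with other f′
  ... | g , v∈g , g≢e , g≢f′
    with JPath-first-edge g≢e (conn _ _ v∈g v∈e)
  ... | _ , j , at-j , g-h = i , j , (λ { refl → at-most-two e-f′ g-h g≢e g≢f′ }) , at-i , at-j

module Unrolled {Γ : Graph} (W : ClosedWalk Γ) where
  open Cyclic (len W) public

  vertexAt : ℕ → V Γ
  vertexAt t = vs W ⟦ t ⟧

  edgeAt : ℕ → E Γ
  edgeAt t = es W ⟦ t ⟧

  step-at : ∀ t → Joins Γ (edgeAt t) (vertexAt t) (vertexAt (suc t))
  step-at t = subst (Joins Γ (edgeAt t) (vertexAt t) ∘ vs W) (next-⟦⟧ t) (step W ⟦ t ⟧)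

  no-U-turn-at : NoUTurn W → ∀ t → edgeAt t ≢ edgeAt (suc t)
  no-U-turn-at noU t e = noU ⟦ suc t ⟧ (trans (cong (es W) (prev-⟦suc⟧ t)) e)

  turnAt-⟦suc⟧ : ∀ α t → turnAt α W ⟦ suc t ⟧ ≡ α (vertexAt (suc t)) (edgeAt t) (edgeAt (suc t))
  turnAt-⟦suc⟧ α t = cong (λ i → α (vertexAt (suc t)) (es W i) (edgeAt (suc t))) (prev-⟦suc⟧ t)

module FromPeriodic {Γ : Graph} (ℓ : ℕ) (f : ℕ → V Γ) (g : ℕ → E Γ)
  (f-periodic : ∀ t → f (suc ℓ + t) ≡ f t) (g-periodic : ∀ t → g (suc ℓ + t) ≡ g t)
  (step-f-g : ∀ t → Joins Γ (g t) (f t) (f (suc t))) where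
  open Cyclic ℓ

  f-⟦⟧ : ∀ t → f (toℕ ⟦ t ⟧) ≡ f t
  f-⟦⟧ = periodic-toℕ-⟦⟧ f f-periodic

  g-⟦⟧ : ∀ t → g (toℕ ⟦ t ⟧) ≡ g t
  g-⟦⟧ = periodic-toℕ-⟦⟧ g g-periodic

  next≡⟦suc⟧ : ∀ i → next i ≡ ⟦ suc (toℕ i) ⟧
  next≡⟦suc⟧ i = trans (cong next (sym (⟦toℕ⟧ i))) (next-⟦⟧ (toℕ i))

  walk : ClosedWalk Γ
  walk = record { len = ℓ ; vs = f ∘ toℕ ; es = g ∘ toℕ ; step = step-walk }
    where
    step-walk : ∀ i → Joins Γ (g (toℕ i)) (f (toℕ i)) (f (toℕ (next i)))
    step-walk i = subst (Joins Γ (g (toℕ i)) (f (toℕ i)))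
                        (sym (trans (cong (f ∘ toℕ) (next≡⟦suc⟧ i)) (f-⟦⟧ (suc (toℕ i)))))
                        (step-f-g (toℕ i))

  edge-before-⟦suc⟧ : ∀ t → g (toℕ (prev ⟦ suc t ⟧)) ≡ g t
  edge-before-⟦suc⟧ t = trans (cong (g ∘ toℕ) (prev-⟦suc⟧ t)) (g-⟦⟧ t)

  noUTurn : (∀ t → g t ≢ g (suc t)) → NoUTurn walk
  noUTurn no-back i = subst (λ j → g (toℕ (prev j)) ≢ g (toℕ j)) ⟦suc-ℓ+toℕ⟧
    λ e → no-back s (trans (sym (edge-before-⟦suc⟧ s)) (trans e (g-⟦⟧ (suc s))))
    where
    s = ℓ + toℕ i
    ⟦suc-ℓ+toℕ⟧ : ⟦ suc s ⟧ ≡ i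
    ⟦suc-ℓ+toℕ⟧ = trans (⟦period+⟧ (toℕ i)) (⟦toℕ⟧ i)

  covers : (∀ e → ∃ λ t → g t ≡ e) → Covers walk
  covers onto e with onto e
  ... | t , refl = ⟦ t ⟧ , g-⟦⟧ t

  jedge : ∀ t {v e e′} → f (suc t) ≡ v → g t ≡ e → g (suc t) ≡ e′ → JEdge walk v e e′
  jedge t refl refl refl = ⟦ suc t ⟧ , f-⟦⟧ (suc t) , inj₁ (sym (edge-before-⟦suc⟧ t) , sym (g-⟦⟧ (suc t)))

  turnCost-walk : ∀ α → turnCost α walk ≡ sum {suc ℓ} (λ i → α (f (suc (toℕ i))) (g (toℕ i)) (g (suc (toℕ i))))
  turnCost-walk α = begin
    turnCost α walk              ≡⟨ turnCost≡sum-turnAt α walk ⟩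
    sum (turnAt α walk)          ≡⟨ sum-∘-next (turnAt α walk) ⟨
    sum (turnAt α walk ∘ next)   ≡⟨ sum-cong-≗ turnAt-next ⟩
    sum {suc ℓ} (λ i → α (f (suc (toℕ i))) (g (toℕ i)) (g (suc (toℕ i)))) ∎
    where
    open ≡-Reasoning
    turnAt-next : ∀ i → turnAt α walk (next i) ≡ α (f (suc (toℕ i))) (g (toℕ i)) (g (suc (toℕ i)))
    turnAt-next i = begin
      turnAt α walk (next i)                          ≡⟨ cong (turnAt α walk) (next≡⟦suc⟧ i) ⟩
      α (f (toℕ ⟦ suc k ⟧)) (g (toℕ (prev ⟦ suc k ⟧))) (g (toℕ ⟦ suc k ⟧))
        ≡⟨ cong₂ (λ u w → α u (g (toℕ (prev ⟦ suc k ⟧))) w) (f-⟦⟧ (suc k)) (g-⟦⟧ (suc k)) ⟩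
      α (f (suc k)) (g (toℕ (prev ⟦ suc k ⟧))) (g (suc k))
        ≡⟨ cong (λ w → α (f (suc k)) w (g (suc k))) (edge-before-⟦suc⟧ k) ⟩
      α (f (suc k)) (g k) (g (suc k))                 ∎
      where k = toℕ i

-- Since a k ≡ a k′ ⇔ a (k + 1) ≡ a (k′ + 1), one repetition makes a periodic.
-- Surjectivity forces every period to be at least n = suc m, and pigeonhole on
-- a 0, …, a n yields a period of at most n.
module ShiftInvariantKernel {m : ℕ} (a : ℕ → Fin (suc m))
  (surjective : ∀ j → ∃ λ k → a k ≡ j)
  (suc-cong : ∀ {k k′} → a k ≡ a k′ → a (suc k) ≡ a (suc k′))
  (suc-cancel : ∀ {k k′} → a (suc k) ≡ a (suc k′) → a k ≡ a k′) where

  private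
    n = suc m

  +-cong : ∀ d {k k′} → a k ≡ a k′ → a (d + k) ≡ a (d + k′)
  +-cong zero e = e
  +-cong (suc d) e = suc-cong (+-cong d e)

  +-cancel : ∀ d {k k′} → a (d + k) ≡ a (d + k′) → a k ≡ a k′
  +-cancel zero e = e
  +-cancel (suc d) e = +-cancel d (suc-cancel e)

  Period : ℕ → Set
  Period d = ∀ k → a (k + d) ≡ a k

  period-of-repeat : ∀ i d → a (i + d) ≡ a i → Period d
  period-of-repeat i d e k = begin
    a (k + d)   ≡⟨ +-cong k (+-cancel i (trans e (cong a (sym (+-identityʳ i))))) ⟩
    a (k + 0)   ≡⟨ cong a (+-identityʳ k) ⟩
    a k         ∎
    where open ≡-Reasoning

  period-reduce : ∀ d → Period (suc d) → ∀ k → a (k % suc d) ≡ a k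
  period-reduce d period = periodic-% a d (λ k → trans (cong a (+-comm (suc d) k)) (period k))

  -- Every value is attained within one period.
  n≤period : ∀ d → Period (suc d) → n ≤ suc d
  n≤period d period = injective⇒≤ {f = λ j → proj₁ (surjective j) mod suc d} inj
    where
    inj : ∀ {j j′} → proj₁ (surjective j) mod suc d ≡ proj₁ (surjective j′) mod suc d → j ≡ j′
    inj {j} {j′} e = begin
      j                                    ≡⟨ proj₂ (surjective j) ⟨
      a k                                  ≡⟨ period-reduce d period k ⟨
      a (k % suc d)                        ≡⟨ cong a (trans (sym (toℕ-fromℕ< (m%n<n k (suc d))))
                                                    (trans (cong toℕ e) (toℕ-fromℕ< (m%n<n k′ (suc d))))) ⟩
      a (k′ % suc d)                       ≡⟨ period-reduce d period k′ ⟩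
      a k′                                 ≡⟨ proj₂ (surjective j′) ⟩
      j′                                   ∎
      where
      open ≡-Reasoning
      k = proj₁ (surjective j)
      k′ = proj₁ (surjective j′)

  gap≥n : ∀ {i j} → i < j → a i ≡ a j → ∃ λ d → j ≡ i + suc d × n ≤ suc d
  gap≥n {i} i<j e with m≤n⇒∃[o]m+o≡n i<j
  ... | d , refl = d , sym (+-suc i d) ,
    n≤period d (period-of-repeat i (suc d) (trans (cong a (+-suc i d)) (sym e)))

  no-repeat-below : ∀ {i j} → i < j → j < n → a i ≢ a j
  no-repeat-below {i} i<j j<n e with gap≥n i<j e
  ... | d , refl , n≤1+d = <⇒≱ (≤-<-trans (m≤n+m (suc d) i) j<n) n≤1+d

  period-n : Period n
  period-n with pigeonhole (n<1+n n) (λ i → a (toℕ i))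
  ... | i , j , i<j , e with gap≥n i<j e
  ... | d , j≡ , n≤1+d = subst Period (≤-antisym 1+d≤n n≤1+d) (period-of-repeat (toℕ i) (suc d) (trans (cong a (sym j≡)) (sym e)))
    where
    1+d≤n : suc d ≤ n
    1+d≤n = ≤-trans (m≤n+m (suc d) (toℕ i)) (subst (_≤ n) j≡ (≤-pred (toℕ<n j)))

  injective : ∀ {i j : Fin n} → a (toℕ i) ≡ a (toℕ j) → i ≡ j
  injective {i} {j} e with <-cmp (toℕ i) (toℕ j)
  ... | tri< i<j _ _ = ⊥-elim (no-repeat-below i<j (toℕ<n j) e)
  ... | tri≈ _ i≡j _ = toℕ-injective i≡j
  ... | tri> _ _ j<i = ⊥-elim (no-repeat-below j<i (toℕ<n i) (sym e))

  a-mod : ∀ k → a (toℕ (k mod n)) ≡ a k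
  a-mod k = trans (cong a (toℕ-fromℕ< (m%n<n k n))) (period-reduce m period-n k)

  surjective-below : ∀ j → ∃ λ (i : Fin n) → a (toℕ i) ≡ j
  surjective-below j with surjective j
  ... | k , refl = k mod n , a-mod k

  a-next : ∀ (i : Fin n) → a (toℕ (next i)) ≡ a (suc (toℕ i))
  a-next i = a-mod (suc (toℕ i))

b-injective : ∀ {n} {i j : Fin n} → b i ≡ b j → i ≡ j
b-injective refl = refl

leave-c : ∀ {n} {e : HE n} {w} → Joins (H n) e c w → ∃ λ j → e ≡ b j × w ≡ x j
leave-c {e = b j} (inj₁ refl) = j , refl , refl
leave-c {e = b _} (inj₂ ())
leave-c {e = xy _} (inj₁ ())
leave-c {e = xy _} (inj₂ ())
leave-c {e = yz _} (inj₁ ())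
leave-c {e = yz _} (inj₂ ())
leave-c {e = zx _} (inj₁ ())
leave-c {e = zx _} (inj₂ ())

leave-x : ∀ {n} {e : HE n} {w j} → Joins (H n) e (x j) w →
          (e ≡ b j × w ≡ c) ⊎ (e ≡ xy j × w ≡ y j) ⊎ (e ≡ zx j × w ≡ z j)
leave-x {e = b _} (inj₁ ())
leave-x {e = b _} (inj₂ refl) = inj₁ (refl , refl)
leave-x {e = xy _} (inj₁ refl) = inj₂ (inj₁ (refl , refl))
leave-x {e = xy _} (inj₂ ())
leave-x {e = yz _} (inj₁ ())
leave-x {e = yz _} (inj₂ ())
leave-x {e = zx _} (inj₁ ())
leave-x {e = zx _} (inj₂ refl) = inj₂ (inj₂ (refl , refl))

leave-y : ∀ {n} {e : HE n} {w j} → Joins (H n) e (y j) w →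
          (e ≡ xy j × w ≡ x j) ⊎ (e ≡ yz j × w ≡ z j)
leave-y {e = b _} (inj₁ ())
leave-y {e = b _} (inj₂ ())
leave-y {e = xy _} (inj₁ ())
leave-y {e = xy _} (inj₂ refl) = inj₁ (refl , refl)
leave-y {e = yz _} (inj₁ refl) = inj₂ (refl , refl)
leave-y {e = yz _} (inj₂ ())
leave-y {e = zx _} (inj₁ ())
leave-y {e = zx _} (inj₂ ())

leave-z : ∀ {n} {e : HE n} {w j} → Joins (H n) e (z j) w →
          (e ≡ yz j × w ≡ y j) ⊎ (e ≡ zx j × w ≡ x j)
leave-z {e = b _} (inj₁ ())
leave-z {e = b _} (inj₂ ())
leave-z {e = xy _} (inj₁ ())
leave-z {e = xy _} (inj₂ ())
leave-z {e = yz _} (inj₁ ())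
leave-z {e = yz _} (inj₂ refl) = inj₁ (refl , refl)
leave-z {e = zx _} (inj₁ refl) = inj₂ (refl , refl)
leave-z {e = zx _} (inj₂ ())

bridge-touches-c : ∀ {n} {j : Fin n} {u w} → Joins (H n) (b j) u w → u ≡ c ⊎ w ≡ c
bridge-touches-c (inj₁ refl) = inj₁ refl
bridge-touches-c (inj₂ refl) = inj₂ refl

third-edge-at-x : ∀ {n} (j : Fin n) f → ∃ λ g → Incident (H n) (x j) g × g ≢ b j × g ≢ f
third-edge-at-x j (b _)  = xy j , inj₁ refl , (λ ()) , (λ ())
third-edge-at-x j (xy _) = zx j , inj₂ refl , (λ ()) , (λ ())
third-edge-at-x j (yz _) = xy j , inj₁ refl , (λ ()) , (λ ())
third-edge-at-x j (zx _) = xy j , inj₁ refl , (λ ()) , (λ ())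

free-turn⇒adjacent : ∀ {n} (G : SimpleGraph n) i j → αH G c (b i) (b j) ≡ 0 → adj G i j ≡ true
free-turn⇒adjacent G i j free with adj G i j
... | true = refl
... | false with free
...   | ()

module Forward {n′ : ℕ} (G : SimpleGraph (suc n′)) (ham : HamiltonianCycle G) where
  private
    n = suc n′
    σ = proj₁ ham
  open Cyclic n′ using (⟦_⟧; ⟦toℕ⟧; next-⟦⟧; ⟦period+⟧)

  arm : ℕ → Fin n
  arm q = σ ⟦ q ⟧

  arm-adj : ∀ q → adj G (arm q) (arm (suc q)) ≡ true
  arm-adj q = subst (λ i → adj G (arm q) (σ i) ≡ true) (next-⟦⟧ q) (proj₂ (proj₂ (proj₂ ham)) ⟦ q ⟧)

  arm-distinct : ∀ q → arm q ≢ arm (suc q)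
  arm-distinct q e with trans (sym (arm-adj q)) (trans (cong (adj G (arm q)) (sym e)) (irrefl G (arm q)))
  ... | ()

  arm-periodic : ∀ q → arm (n + q) ≡ arm q
  arm-periodic q = cong σ (⟦period+⟧ q)

  arm-onto : ∀ j → ∃ λ q → arm q ≡ j
  arm-onto j with proj₁ (proj₂ (proj₂ ham)) j
  ... | i , refl = toℕ i , cong σ (⟦toℕ⟧ i)

  -- tourV q t is the vertex t steps after the tour leaves c for the q-th arm of
  -- the Hamiltonian cycle; each arm takes the five steps c, x, y, z, x.
  tourV : ℕ → ℕ → HV n
  tourV q 0 = c
  tourV q 1 = x (arm q)
  tourV q 2 = y (arm q)
  tourV q 3 = z (arm q)
  tourV q 4 = x (arm q)
  tourV q (suc (suc (suc (suc (suc t))))) = tourV (suc q) t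

  tourE : ℕ → ℕ → HE n
  tourE q 0 = b (arm q)
  tourE q 1 = xy (arm q)
  tourE q 2 = yz (arm q)
  tourE q 3 = zx (arm q)
  tourE q 4 = b (arm q)
  tourE q (suc (suc (suc (suc (suc t))))) = tourE (suc q) t

  tourV-skip : ∀ k q t → tourV q (k * 5 + t) ≡ tourV (k + q) t
  tourV-skip zero q t = refl
  tourV-skip (suc k) q t = trans (tourV-skip k (suc q) t) (cong (λ u → tourV u t) (+-suc k q))

  tourE-skip : ∀ k q t → tourE q (k * 5 + t) ≡ tourE (k + q) t
  tourE-skip zero q t = refl
  tourE-skip (suc k) q t = trans (tourE-skip k (suc q) t) (cong (λ u → tourE u t) (+-suc k q))

  tourV-periodic : ∀ q t → tourV (n + q) t ≡ tourV q t
  tourV-periodic q 0 = refl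
  tourV-periodic q 1 = cong x (arm-periodic q)
  tourV-periodic q 2 = cong y (arm-periodic q)
  tourV-periodic q 3 = cong z (arm-periodic q)
  tourV-periodic q 4 = cong x (arm-periodic q)
  tourV-periodic q (suc (suc (suc (suc (suc t))))) =
    trans (cong (λ u → tourV u t) (sym (+-suc n q))) (tourV-periodic (suc q) t)

  tourE-periodic : ∀ q t → tourE (n + q) t ≡ tourE q t
  tourE-periodic q 0 = cong b (arm-periodic q)
  tourE-periodic q 1 = cong xy (arm-periodic q)
  tourE-periodic q 2 = cong yz (arm-periodic q)
  tourE-periodic q 3 = cong zx (arm-periodic q)
  tourE-periodic q 4 = cong b (arm-periodic q)
  tourE-periodic q (suc (suc (suc (suc (suc t))))) =
    trans (cong (λ u → tourE u t) (sym (+-suc n q))) (tourE-periodic (suc q) t)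

  tour-step : ∀ q t → Joins (H n) (tourE q t) (tourV q t) (tourV q (suc t))
  tour-step q 0 = inj₁ refl
  tour-step q 1 = inj₁ refl
  tour-step q 2 = inj₁ refl
  tour-step q 3 = inj₁ refl
  tour-step q 4 = inj₂ refl
  tour-step q (suc (suc (suc (suc (suc t))))) = tour-step (suc q) t

  tour-no-U-turn : ∀ q t → tourE q t ≢ tourE q (suc t)
  tour-no-U-turn q 0 ()
  tour-no-U-turn q 1 ()
  tour-no-U-turn q 2 ()
  tour-no-U-turn q 3 ()
  tour-no-U-turn q 4 e = arm-distinct q (b-injective e)
  tour-no-U-turn q (suc (suc (suc (suc (suc t))))) = tour-no-U-turn (suc q) t

  turn : ℕ → ℕ → ℕ
  turn q t = αH G (tourV q (suc t)) (tourE q t) (tourE q (suc t))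

  -- Per arm: four turns of cost 1 at x, y, z, x, and a free turn at c because
  -- consecutive arms are adjacent in G.
  sum-turn : ∀ k q → sum {k * 5} (λ i → turn q (toℕ i)) ≡ k * 4
  sum-turn zero q = refl
  sum-turn (suc k) q = cong₂ (λ u v → 1 + (1 + (1 + (1 + (u + v))))) turn-at-c (sum-turn k (suc q))
    where
    turn-at-c : turn q 4 ≡ 0
    turn-at-c rewrite arm-adj q = refl

  open FromPeriodic {H n} (4 + n′ * 5) (tourV 0) (tourE 0)
    (λ t → trans (tourV-skip n 0 t) (tourV-periodic 0 t))
    (λ t → trans (tourE-skip n 0 t) (tourE-periodic 0 t))
    (tour-step 0)
    using (walk; noUTurn; covers; jedge; turnCost-walk)

  tourV-at : ∀ q t → tourV 0 (q * 5 + t) ≡ tourV q t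
  tourV-at q t = trans (tourV-skip q 0 t) (cong (λ u → tourV u t) (+-identityʳ q))

  tourE-at : ∀ q t → tourE 0 (q * 5 + t) ≡ tourE q t
  tourE-at q t = trans (tourE-skip q 0 t) (cong (λ u → tourE u t) (+-identityʳ q))

  turn-edge : ∀ q r → JEdge walk (tourV q (suc r)) (tourE q r) (tourE q (suc r))
  turn-edge q r = jedge (q * 5 + r)
    (trans (cong (tourV 0) (sym (+-suc (q * 5) r))) (tourV-at q (suc r)))
    (tourE-at q r)
    (trans (cong (tourE 0) (sym (+-suc (q * 5) r))) (tourE-at q (suc r)))

  path-c : ∀ q → JPath walk c (b (arm 0)) (b (arm q))
  path-c zero = here
  path-c (suc q) = path-c q ++ᴶ there (turn-edge q 4) here

  reach-c : ∀ e → Incident (H n) c e → JPath walk c (b (arm 0)) e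
  reach-c (b j) (inj₁ refl) with arm-onto j
  ... | q , refl = path-c q
  reach-c (b _) (inj₂ ())
  reach-c (xy _) (inj₁ ())
  reach-c (xy _) (inj₂ ())
  reach-c (yz _) (inj₁ ())
  reach-c (yz _) (inj₂ ())
  reach-c (zx _) (inj₁ ())
  reach-c (zx _) (inj₂ ())

  reach-x : ∀ q e → Incident (H n) (x (arm q)) e → JPath walk (x (arm q)) (b (arm q)) e
  reach-x q (b _) (inj₂ refl) = here
  reach-x q (xy _) (inj₁ refl) = there (turn-edge q 0) here
  reach-x q (zx _) (inj₂ refl) = there (JEdge-sym {W = walk} (turn-edge q 3)) here
  reach-x q (b _) (inj₁ ())
  reach-x q (xy _) (inj₂ ())
  reach-x q (yz _) (inj₁ ())
  reach-x q (yz _) (inj₂ ())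
  reach-x q (zx _) (inj₁ ())

  reach-y : ∀ q e → Incident (H n) (y (arm q)) e → JPath walk (y (arm q)) (xy (arm q)) e
  reach-y q (xy _) (inj₂ refl) = here
  reach-y q (yz _) (inj₁ refl) = there (turn-edge q 1) here
  reach-y q (b _) (inj₁ ())
  reach-y q (b _) (inj₂ ())
  reach-y q (xy _) (inj₁ ())
  reach-y q (yz _) (inj₂ ())
  reach-y q (zx _) (inj₁ ())
  reach-y q (zx _) (inj₂ ())

  reach-z : ∀ q e → Incident (H n) (z (arm q)) e → JPath walk (z (arm q)) (yz (arm q)) e
  reach-z q (yz _) (inj₂ refl) = here
  reach-z q (zx _) (inj₁ refl) = there (turn-edge q 2) here
  reach-z q (b _) (inj₁ ())
  reach-z q (b _) (inj₂ ())
  reach-z q (xy _) (inj₁ ())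
  reach-z q (xy _) (inj₂ ())
  reach-z q (yz _) (inj₁ ())
  reach-z q (zx _) (inj₂ ())

  connected : ∀ v → JunctionConnected walk v
  connected c = connected-via (b (arm 0)) reach-c
  connected (x j) with arm-onto j
  ... | q , refl = connected-via (b (arm q)) (reach-x q)
  connected (y j) with arm-onto j
  ... | q , refl = connected-via (xy (arm q)) (reach-y q)
  connected (z j) with arm-onto j
  ... | q , refl = connected-via (yz (arm q)) (reach-z q)

  tourE-onto : ∀ e → ∃ λ t → tourE 0 t ≡ e
  tourE-onto (b j) with arm-onto j
  ... | q , refl = q * 5 + 0 , tourE-at q 0
  tourE-onto (xy j) with arm-onto j
  ... | q , refl = q * 5 + 1 , tourE-at q 1
  tourE-onto (yz j) with arm-onto j
  ... | q , refl = q * 5 + 2 , tourE-at q 2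
  tourE-onto (zx j) with arm-onto j
  ... | q , refl = q * 5 + 3 , tourE-at q 3

  threading : IsThreading walk
  threading = record
    { covers    = covers tourE-onto
    ; noUTurn   = noUTurn (tour-no-U-turn 0)
    ; connected = connected
    }

  threading-cost : turnCost (αH G) walk ≡ 4 * n
  threading-cost = trans (turnCost-walk (αH G)) (trans (sum-turn n 0) (*-comm n 4))

  cheap-threading : Σ (ClosedWalk (H n)) λ W → IsThreading W × turnCost (αH G) W ≡ 4 * n
  cheap-threading = walk , threading , threading-cost

module Backward {n′ : ℕ} (G : SimpleGraph (suc n′)) (W : ClosedWalk (H (suc n′)))
                (threading : IsThreading W) (cost≡4n : turnCost (αH G) W ≡ 4 * suc n′) where
  private
    n = suc n′
  open IsThreading threading
  open Unrolled W

  weight : Fin (suc (len W)) → ℕ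
  weight = turnAt (αH G) W

  weight-off-c : ∀ p → vs W p ≢ c → 1 ≤ weight p
  weight-off-c p off with vs W p
  ... | c = ⊥-elim (off refl)
  ... | x _ = s≤s z≤n
  ... | y _ = s≤s z≤n
  ... | z _ = s≤s z≤n

  -- The four visits each arm needs: two at x (J(x_j) has three vertices), one
  -- each at y and z.
  visit-vertex : Fin n → Fin 4 → HV n
  visit-vertex j 0F = x j
  visit-vertex j 1F = x j
  visit-vertex j 2F = y j
  visit-vertex j 3F = z j

  x-visits : ∀ j → ∃₂ λ p p′ → p ≢ p′ × vs W p ≡ x j × vs W p′ ≡ x j
  x-visits j = visited-twice (connected (x j)) {b j} {xy j} (inj₂ refl) (inj₁ refl) (λ ()) (third-edge-at-x j)

  y-visit : ∀ j → ∃ λ p → vs W p ≡ y j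
  y-visit j = visited (connected (y j)) {xy j} {yz j} (inj₂ refl) (inj₁ refl) (λ ())

  z-visit : ∀ j → ∃ λ p → vs W p ≡ z j
  z-visit j = visited (connected (z j)) {yz j} {zx j} (inj₂ refl) (inj₁ refl) (λ ())

  visit : Fin n → Fin 4 → Fin (suc (len W))
  visit j 0F = proj₁ (x-visits j)
  visit j 1F = proj₁ (proj₂ (x-visits j))
  visit j 2F = proj₁ (y-visit j)
  visit j 3F = proj₁ (z-visit j)

  visit-at : ∀ j r → vs W (visit j r) ≡ visit-vertex j r
  visit-at j 0F = proj₁ (proj₂ (proj₂ (proj₂ (x-visits j))))
  visit-at j 1F = proj₂ (proj₂ (proj₂ (proj₂ (x-visits j))))
  visit-at j 2F = proj₂ (y-visit j)
  visit-at j 3F = proj₂ (z-visit j)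

  visit-injective : Injective _≡_ _≡_ (uncurry visit)
  visit-injective {j , r} {j′ , r′} e = same-vertex j j′ r r′ (trans (sym (visit-at j r)) (trans (cong (vs W) e) (visit-at j′ r′))) e
    where
    x-visits-differ : ∀ j → visit j 0F ≢ visit j 1F
    x-visits-differ j = proj₁ (proj₂ (proj₂ (x-visits j)))
    same-vertex : ∀ j j′ r r′ → visit-vertex j r ≡ visit-vertex j′ r′ → visit j r ≡ visit j′ r′ → (j , r) ≡ (j′ , r′)
    same-vertex j _ 0F 0F refl _ = refl
    same-vertex j _ 0F 1F refl e = ⊥-elim (x-visits-differ j e)
    same-vertex j _ 1F 0F refl e = ⊥-elim (x-visits-differ j (sym e))
    same-vertex j _ 1F 1F refl _ = refl
    same-vertex j _ 2F 2F refl _ = refl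
    same-vertex j _ 3F 3F refl _ = refl
    same-vertex _ _ 0F 2F () _
    same-vertex _ _ 0F 3F () _
    same-vertex _ _ 1F 2F () _
    same-vertex _ _ 1F 3F () _
    same-vertex _ _ 2F 0F () _
    same-vertex _ _ 2F 1F () _
    same-vertex _ _ 2F 3F () _
    same-vertex _ _ 3F 0F () _
    same-vertex _ _ 3F 1F () _
    same-vertex _ _ 3F 2F () _

  visit-vertex-off-c : ∀ j r → visit-vertex j r ≢ c
  visit-vertex-off-c j 0F ()
  visit-vertex-off-c j 1F ()
  visit-vertex-off-c j 2F ()
  visit-vertex-off-c j 3F ()

  visit-off-c : ∀ j r → vs W (visit j r) ≢ c
  visit-off-c j r at-c = visit-vertex-off-c j r (trans (sym (visit-at j r)) at-c)

  sum-weight≤ : sum weight ≤ n * 4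
  sum-weight≤ = ≤-reflexive (trans (sym (turnCost≡sum-turnAt (αH G) W)) (trans cost≡4n (*-comm 4 n)))

  heavy⇒visit : ∀ p → 1 ≤ weight p → ∃₂ λ j r → visit j r ≡ p
  heavy⇒visit p 1≤w with weight-in-image encoded encoded-injective
                           (λ k → weight-off-c _ (uncurry visit-off-c (remQuot {n} 4 k))) sum-weight≤ p 1≤w
    where
    encoded : Fin (n * 4) → Fin (suc (len W))
    encoded = uncurry visit ∘ remQuot {n} 4
    encoded-injective : Injective _≡_ _≡_ encoded
    encoded-injective {k} {k′} e = trans (sym (Finₚ.combine-remQuot {n} 4 k))
      (trans (cong (uncurry combine) (visit-injective {remQuot {n} 4 k} {remQuot {n} 4 k′} e))
             (Finₚ.combine-remQuot {n} 4 k′))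
  ... | k , refl = proj₁ (remQuot {n} 4 k) , proj₂ (remQuot {n} 4 k) , refl

  turn-at-c-free : ∀ p → vs W p ≡ c → weight p ≡ 0
  turn-at-c-free p at-c = n<1⇒n≡0 (≰⇒> λ 1≤w → visited-off-c (heavy⇒visit p 1≤w))
    where
    visited-off-c : ¬ ∃₂ λ j r → visit j r ≡ p
    visited-off-c (j , r , refl) = visit-off-c j r at-c

  visit-at-vertex : ∀ {p v} → vs W p ≡ v → v ≢ c → ∃₂ λ j r → visit j r ≡ p × visit-vertex j r ≡ v
  visit-at-vertex {p} at v≢c with heavy⇒visit p (weight-off-c p (λ at-c → v≢c (trans (sym at) at-c)))
  ... | j , r , refl = j , r , refl , trans (sym (visit-at j r)) at

  x-visited-at : ∀ {p j} → vs W p ≡ x j → p ≡ visit j 0F ⊎ p ≡ visit j 1F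
  x-visited-at at with visit-at-vertex at (λ ())
  ... | _ , 0F , refl , refl = inj₁ refl
  ... | _ , 1F , refl , refl = inj₂ refl
  ... | _ , 2F , _ , ()
  ... | _ , 3F , _ , ()

  y-visited-at : ∀ {p j} → vs W p ≡ y j → p ≡ visit j 2F
  y-visited-at at with visit-at-vertex at (λ ())
  ... | _ , 2F , refl , refl = refl
  ... | _ , 0F , _ , ()
  ... | _ , 1F , _ , ()
  ... | _ , 3F , _ , ()

  z-visited-at : ∀ {p j} → vs W p ≡ z j → p ≡ visit j 3F
  z-visited-at at with visit-at-vertex at (λ ())
  ... | _ , 3F , refl , refl = refl
  ... | _ , 0F , _ , ()
  ... | _ , 1F , _ , ()
  ... | _ , 2F , _ , ()

  x-visited-twice : ∀ {p p′ p″ j} → p ≢ p′ → vs W p ≡ x j → vs W p′ ≡ x j → vs W p″ ≡ x j →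
                    p″ ≡ p ⊎ p″ ≡ p′
  x-visited-twice p≢p′ at at′ at″ with x-visited-at at | x-visited-at at′ | x-visited-at at″
  ... | inj₁ refl | _         | inj₁ refl = inj₁ refl
  ... | inj₂ refl | _         | inj₂ refl = inj₁ refl
  ... | inj₁ refl | inj₂ refl | inj₂ refl = inj₂ refl
  ... | inj₂ refl | inj₁ refl | inj₁ refl = inj₂ refl
  ... | inj₁ refl | inj₁ refl | inj₂ _    = ⊥-elim (p≢p′ refl)
  ... | inj₂ refl | inj₂ refl | inj₁ _    = ⊥-elim (p≢p′ refl)

  leaving : ∀ t {u} → vertexAt t ≡ u → Joins (H n) (edgeAt t) u (vertexAt (suc t))
  leaving t refl = step-at t

  U-turn : ∀ t → edgeAt t ≡ edgeAt (suc t) → ⊥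
  U-turn = no-U-turn-at noUTurn

  free-turn-at-c : ∀ t → vertexAt (suc t) ≡ c → αH G c (edgeAt t) (edgeAt (suc t)) ≡ 0
  free-turn-at-c t at-c = subst (λ u → αH G u (edgeAt t) (edgeAt (suc t)) ≡ 0) at-c
    (trans (sym (turnAt-⟦suc⟧ (αH G) t)) (turn-at-c-free ⟦ suc t ⟧ at-c))

  Departs : ℕ → Fin n → Set
  Departs t j = vertexAt t ≡ c × edgeAt t ≡ b j

  departs : ∀ t → vertexAt t ≡ c → ∃ λ j → Departs t j
  departs t at-c with leave-c (leaving t at-c)
  ... | j , leave-b , _ = j , at-c , leave-b

  record Excursion (s : ℕ) (j : Fin n) : Set where
    field
      first-x  : vertexAt (1 + s) ≡ x j
      inner₂   : vertexAt (2 + s) ≢ c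
      inner₃   : vertexAt (3 + s) ≢ c
      second-x : vertexAt (4 + s) ≡ x j
      returns  : edgeAt (4 + s) ≡ b j
      next-arm : Fin n
      departs-next : Departs (5 + s) next-arm
      adjacent : adj G j next-arm ≡ true

  private
    not-c : ∀ t {u} → vertexAt t ≡ u → u ≢ c → vertexAt t ≢ c
    not-c _ at u≢c e = u≢c (trans (sym at) e)

    no-second-lap : ∀ s → vertexAt s ≡ c → vertexAt (3 + s) ≢ c → ⟦ 5 + s ⟧ ≢ ⟦ 2 + s ⟧
    no-second-lap _ at-c inner₃ e = inner₃ (trans (cong (vs W) (⟦⟧-cancelˡ 2 e)) at-c)

    back-at-c : ∀ s {j} → vertexAt (1 + s) ≡ x j → vertexAt (2 + s) ≢ c → vertexAt (3 + s) ≢ c →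
                vertexAt (4 + s) ≡ x j → edgeAt (4 + s) ≡ b j → vertexAt (5 + s) ≡ c → Excursion s j
    back-at-c s {j} at-x₁ inner₂ inner₃ at-x₂ returns at-c′ with departs (5 + s) at-c′
    ... | j′ , departs′ = record
      { first-x = at-x₁ ; inner₂ = inner₂ ; inner₃ = inner₃ ; second-x = at-x₂ ; returns = returns
      ; next-arm = j′ ; departs-next = departs′
      ; adjacent = free-turn⇒adjacent G j j′
          (subst₂ (λ e f → αH G c e f ≡ 0) returns (proj₂ departs′) (free-turn-at-c (4 + s) at-c′)) }

  excursion : ∀ {s j} → Departs s j → Excursion s j
  excursion {s} {j} (at-c , leave-b) with leave-c (leaving s at-c)
  ... | j₀ , leave-b₀ , at-x₁ with b-injective (trans (sym leave-b₀) leave-b)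
  ... | refl with leave-x (leaving (1 + s) at-x₁)
  ... | inj₁ (e₁ , _) = ⊥-elim (U-turn s (trans leave-b (sym e₁)))
  ... | inj₂ (inj₁ (e₁ , at-y)) = via-y
    where
    via-y : Excursion s j
    via-y with leave-y (leaving (2 + s) at-y)
    ... | inj₁ (e₂ , _) = ⊥-elim (U-turn (1 + s) (trans e₁ (sym e₂)))
    ... | inj₂ (e₂ , at-z) with leave-z (leaving (3 + s) at-z)
    ... | inj₁ (e₃ , _) = ⊥-elim (U-turn (2 + s) (trans e₂ (sym e₃)))
    ... | inj₂ (e₃ , at-x₂) with leave-x (leaving (4 + s) at-x₂)
    ... | inj₁ (e₄ , at-c′) = back-at-c s at-x₁ (not-c (2 + s) at-y λ ()) (not-c (3 + s) at-z λ ()) at-x₂ e₄ at-c′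
    ... | inj₂ (inj₁ (_ , at-y′)) = ⊥-elim (no-second-lap s at-c (not-c (3 + s) at-z λ ()) (trans (y-visited-at at-y′) (sym (y-visited-at at-y))))
    ... | inj₂ (inj₂ (e₄ , _)) = ⊥-elim (U-turn (3 + s) (trans e₃ (sym e₄)))
  ... | inj₂ (inj₂ (e₁ , at-z)) = via-z
    where
    via-z : Excursion s j
    via-z with leave-z (leaving (2 + s) at-z)
    ... | inj₂ (e₂ , _) = ⊥-elim (U-turn (1 + s) (trans e₁ (sym e₂)))
    ... | inj₁ (e₂ , at-y) with leave-y (leaving (3 + s) at-y)
    ... | inj₂ (e₃ , _) = ⊥-elim (U-turn (2 + s) (trans e₂ (sym e₃)))
    ... | inj₁ (e₃ , at-x₂) with leave-x (leaving (4 + s) at-x₂)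
    ... | inj₁ (e₄ , at-c′) = back-at-c s at-x₁ (not-c (2 + s) at-z λ ()) (not-c (3 + s) at-y λ ()) at-x₂ e₄ at-c′
    ... | inj₂ (inj₂ (_ , at-z′)) = ⊥-elim (no-second-lap s at-c (not-c (3 + s) at-y λ ()) (trans (z-visited-at at-z′) (sym (z-visited-at at-z))))
    ... | inj₂ (inj₁ (e₄ , _)) = ⊥-elim (U-turn (3 + s) (trans e₃ (sym e₄)))

  bridge-crossing : ∀ j → ∃ λ t → edgeAt t ≡ b j × (vertexAt t ≡ c ⊎ vertexAt (suc t) ≡ c)
  bridge-crossing j with covers (b j)
  ... | p , on-b = toℕ p , on-b′ ,
        bridge-touches-c (subst (λ e → Joins (H n) e (vertexAt (toℕ p)) (vertexAt (suc (toℕ p)))) on-b′ (step-at (toℕ p)))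
    where
    on-b′ : edgeAt (toℕ p) ≡ b j
    on-b′ = trans (cong (es W) (⟦toℕ⟧ p)) on-b

  module Arms (t₀ : ℕ) (start : vertexAt t₀ ≡ c) where

    departure-time : ℕ → ℕ
    departure-time k = k * 5 + t₀

    departure : ∀ k → ∃ λ j → Departs (departure-time k) j
    departure zero = departs t₀ start
    departure (suc k) = Excursion.next-arm tour-k , Excursion.departs-next tour-k
      where tour-k = excursion (proj₂ (departure k))

    arm : ℕ → Fin n
    arm k = proj₁ (departure k)

    tour : ∀ k → Excursion (departure-time k) (arm k)
    tour k = excursion (proj₂ (departure k))

    same-time⇒same-arm : ∀ {k k′} → ⟦ departure-time k ⟧ ≡ ⟦ departure-time k′ ⟧ → arm k ≡ arm k′
    same-time⇒same-arm {k} {k′} e =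
      b-injective (trans (sym (proj₂ (proj₂ (departure k)))) (trans (cong (es W) e) (proj₂ (proj₂ (departure k′)))))

    -- Entering arm k′ cannot be the return through x of arm k: the walk is at c
    -- one step after the latter, but not one step after the former.
    entry≢return : ∀ k k′ → ⟦ 1 + departure-time k′ ⟧ ≢ ⟦ 4 + departure-time k ⟧
    entry≢return k k′ e = Excursion.inner₂ (tour k′)
      (trans (cong (vs W) (⟦⟧-congˡ 1 e)) (proj₁ (Excursion.departs-next (tour k))))

    same-arm⇒same-time : ∀ {k k′} → arm k ≡ arm k′ → ⟦ departure-time k ⟧ ≡ ⟦ departure-time k′ ⟧
    same-arm⇒same-time {k} {k′} same
      with x-visited-twice (entry≢return k k) (Excursion.first-x (tour k)) (Excursion.second-x (tour k))
             (trans (Excursion.first-x (tour k′)) (cong x (sym same)))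
    ... | inj₁ e = ⟦⟧-cancelˡ 1 (sym e)
    ... | inj₂ e = ⊥-elim (entry≢return k k′ e)

    -- A representative of t − t₀ modulo the length of W that is at least t,
    -- so that offset (suc t) is never 0.
    offset : ℕ → ℕ
    offset t = t + t₀ * len W

    ⟦offset+t₀⟧ : ∀ t → ⟦ offset t + t₀ ⟧ ≡ ⟦ t ⟧
    ⟦offset+t₀⟧ t = begin
      ⟦ (t + t₀ * len W) + t₀ ⟧   ≡⟨ cong ⟦_⟧ (+-assoc t (t₀ * len W) t₀) ⟩
      ⟦ t + (t₀ * len W + t₀) ⟧   ≡⟨ cong (λ u → ⟦ t + u ⟧) (trans (+-comm (t₀ * len W) t₀) (sym (*-suc t₀ (len W)))) ⟩
      ⟦ t + t₀ * suc (len W) ⟧    ≡⟨ ⟦+*period⟧ t t₀ ⟩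
      ⟦ t ⟧                        ∎
      where open ≡-Reasoning

    c-offset : ∀ t → vertexAt t ≡ c → ∃ λ q → offset t ≡ q * 5
    c-offset t at-c = residue (m % 5) (m%n<n m 5) refl
      where
      m = offset t
      q = m / 5
      m≡ : m ≡ m % 5 + q * 5
      m≡ = m≡m%n+[m/n]*n m 5
      at : ∀ r → m % 5 ≡ r → vertexAt (r + departure-time q) ≡ c
      at r e = trans (cong (vs W) (trans (cong ⟦_⟧ (sym m+t₀≡)) (⟦offset+t₀⟧ t))) at-c
        where
        m+t₀≡ : m + t₀ ≡ r + departure-time q
        m+t₀≡ = trans (cong (_+ t₀) (trans m≡ (cong (_+ q * 5) e))) (+-assoc r (q * 5) t₀)
      residue : ∀ r → r < 5 → m % 5 ≡ r → ∃ λ q → m ≡ q * 5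
      residue 0 _ e = q , trans m≡ (cong (_+ q * 5) e)
      residue 1 _ e = ⊥-elim (not-c (1 + departure-time q) (Excursion.first-x (tour q)) (λ ()) (at 1 e))
      residue 2 _ e = ⊥-elim (Excursion.inner₂ (tour q) (at 2 e))
      residue 3 _ e = ⊥-elim (Excursion.inner₃ (tour q) (at 3 e))
      residue 4 _ e = ⊥-elim (not-c (4 + departure-time q) (Excursion.second-x (tour q)) (λ ()) (at 4 e))
      residue (suc (suc (suc (suc (suc _))))) (s≤s (s≤s (s≤s (s≤s (s≤s ()))))) _

    departure-time≡ : ∀ t q → offset t ≡ q * 5 → ⟦ departure-time q ⟧ ≡ ⟦ t ⟧
    departure-time≡ t q e = trans (cong (λ u → ⟦ u + t₀ ⟧) (sym e)) (⟦offset+t₀⟧ t)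

    arm-onto : ∀ j → ∃ λ k → arm k ≡ j
    arm-onto j with bridge-crossing j
    ... | t , on-b , inj₁ at-c with c-offset t at-c
    ...   | q , e = q , b-injective (trans (sym (proj₂ (proj₂ (departure q))))
                                      (trans (cong (es W) (departure-time≡ t q e)) on-b))
    arm-onto j | t , on-b , inj₂ at-c with c-offset (suc t) at-c
    ...   | zero , ()
    ...   | suc q , e = q , b-injective (trans (sym (Excursion.returns (tour q)))
                                          (trans (cong (es W) (⟦⟧-cancelˡ 1 (departure-time≡ (suc t) (suc q) e))) on-b))

    hamiltonian : HamiltonianCycle G
    hamiltonian = arm ∘ toℕ , injective , surjective-below , adjacent
      where
      open ShiftInvariantKernel arm arm-onto
        (λ {k} {k′} same → same-time⇒same-arm {suc k} {suc k′} (⟦⟧-congˡ 5 (same-arm⇒same-time {k} {k′} same)))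
        (λ {k} {k′} same → same-time⇒same-arm {k} {k′} (⟦⟧-cancelˡ 5 (same-arm⇒same-time {suc k} {suc k′} same)))
      adjacent : ∀ i → adj G (arm (toℕ i)) (arm (toℕ (next i))) ≡ true
      adjacent i = subst (λ j → adj G (arm (toℕ i)) j ≡ true) (sym (a-next i)) (Excursion.adjacent (tour (toℕ i)))

  hamiltonian : HamiltonianCycle G
  hamiltonian with bridge-crossing Fin.zero
  ... | t , _ , inj₁ at-c = Arms.hamiltonian t at-c
  ... | t , _ , inj₂ at-c = Arms.hamiltonian (suc t) at-c

-- 3 ≤ n is used only to exclude n = 0.
lemma6 : (n : ℕ) → 3 ≤ n → (G : SimpleGraph n) →
    HamiltonianCycle G ⇔
      (Σ (ClosedWalk (H n)) λ W → IsThreading W × turnCost (αH G) W ≡ 4 * n)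
lemma6 (suc n′) _ G = mk⇔
  (Forward.cheap-threading G)
  (λ { (W , threading , cost) → Backward.hamiltonian G W threading cost })
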